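{- Let $n\ge1$ and let $t$ be a nonnegative integer with $t\le\lfloor n/2\rfloor+1$. Let $T'$ be the set of all tuples in $\{0,1\}^n$ with exactly $t-1$ ones (empty if $t=0$) and $T''$ the set of all tuples in $\{0,1\}^n$ with exactly $t$ ones. Then $(T',T'')$ has the maximum cardinality among all pairs in $\mathcal A'_t$.
   Context: $\{0,1\}^n$ is ordered componentwise; an antichain is a set of pairwise incomparable tuples. $\mathcal A'_t$ is the set of pairs $(T',T'')$ of antichains in $\{0,1\}^n$ such that there are no $\tilde\alpha'\in T'$, $\tilde\alpha''\in T''$ with $\tilde\alpha'\ge\tilde\alpha''$, and every tuple of $T'\cup T''$ has at most $t$ ones. The cardinality of such a pair is $|T'|+|T''|$. -}

module Defs where

open import Data.Bool using (Bool; true; false)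
import Data.Bool as B
open import Data.Nat using (ℕ; zero; suc; _≤_; _≟_)
open import Data.Vec using (Vec; []; _∷_)
open import Data.List using (List; []; _∷_; map; _++_; filter)
open import Data.List.Membership.Propositional using (_∈_)
open import Data.List.Relation.Unary.Unique.Propositional using (Unique)
open import Data.List.Relation.Unary.All using (All)
open import Data.Vec.Relation.Binary.Pointwise.Inductive using (Pointwise)
open import Relation.Binary.PropositionalEquality using (_≡_)
open import Relation.Nullary using (¬_)
open import Data.Product using (_×_)

-- Componentwise order on {0,1}^n (false = 0 ≤ true = 1).
_≼_ : ∀ {n} → Vec Bool n → Vec Bool n → Set
_≼_ = Pointwise B._≤_

ones : ∀ {n} → Vec Bool n → ℕ
ones [] = 0
ones (true ∷ v) = suc (ones v)
ones (false ∷ v) = ones v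

allTuples : (n : ℕ) → List (Vec Bool n)
allTuples zero = [] ∷ []
allTuples (suc n) = map (false ∷_) (allTuples n) ++ map (true ∷_) (allTuples n)

level : (n k : ℕ) → List (Vec Bool n)
level n k = filter (λ v → ones v ≟ k) (allTuples n)

levelPred : (n t : ℕ) → List (Vec Bool n)
levelPred n zero = []
levelPred n (suc k) = level n k

-- A finite set of tuples is a duplicate-free list; its cardinality is its length.
-- Antichain: pairwise incomparable elements.
IsAntichain : ∀ {n} → List (Vec Bool n) → Set
IsAntichain T = Unique T × (∀ {a b} → a ∈ T → b ∈ T → a ≼ b → a ≡ b)

InA' : (n t : ℕ) → List (Vec Bool n) → List (Vec Bool n) → Set
InA' n t T' T'' =
  IsAntichain T' × IsAntichain T''
  × (∀ {a b} → a ∈ T' → b ∈ T'' → ¬ (b ≼ a))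
  × All (λ v → ones v ≤ t) T' × All (λ v → ones v ≤ t) T''

module Submission where

-- Give a tuple x with k ones the weight k!(n-k)!, and a list of
-- tuples the total weight of its members.  The LYM inequality says that an
-- antichain has total weight at most n!; a level {x : |x| = k} has exactly
-- (n choose k) members, each of weight k!(n-k)!, hence total weight exactly n!.
-- For (T', T'') in 𝒜'_t the two antichains are disjoint, so F = T' ++ T'' is a
-- duplicate-free list of tuples with at most t ones and total weight ≤ 2·n!.
-- Weights decrease towards the middle level, and 2(t-1) ≤ n, so every level
-- below t-1 is at least as heavy as levels t-1 and t.  Call A the lighter and
-- B the heavier of the levels t-1, t: every member of F off level A then
-- weighs at least as much as a member of level B, and F has at most
-- (n choose A) members on level A; a weighted count bounds |F| by
-- (n choose A) + (n choose B).

open import Defs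
open import Data.Bool using (Bool; true; false; if_then_else_)
import Data.Bool as B
import Data.Bool.Properties as B
open import Data.Empty using (⊥-elim)
open import Data.Fin using (Fin; zero; suc)
open import Data.List using (List; []; _∷_; _++_; length; map; filter)
open import Data.List.Properties
  using (length-++; length-++-sucʳ; map-++; map-cong-local; filter-++; filter-none; filter-≐)
open import Data.List.Membership.Propositional using (_∈_; find)
open import Data.List.Membership.Propositional.Properties
  using (∈-++⁺ˡ; ∈-++⁺ʳ; ∈-map⁺; ∈-map⁻; ∈-∃++; ∈-filter⁺; ∈-filter⁻)
open import Data.List.Relation.Unary.All as All using (All; []; _∷_)
open import Data.List.Relation.Unary.All.Properties using (¬Any⇒All¬; ++⁺)
open import Data.List.Relation.Unary.AllPairs using (AllPairs; []; _∷_)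
open import Data.List.Relation.Unary.Any using (here; there; any?)
open import Data.List.Relation.Unary.Unique.Propositional using (Unique)
import Data.List.Relation.Unary.Unique.Propositional.Properties as Unique
open import Data.Nat
  using (ℕ; zero; suc; _+_; _*_; _∸_; _/_; _!; _≤_; z≤n; s≤s; s≤s⁻¹; _≟_; _≤?_; NonZero)
open import Data.Nat.Properties
open import Algebra.Properties.CommutativeMonoid.Sum +-0-commutativeMonoid
  using (sum-syntax; ∑-distrib-+; sum-replicate-zero)
open import Algebra.Properties.CommutativeSemigroup +-commutativeSemigroup using (interchange)
open import Data.Nat.Combinatorics using (_C_; nCk+nC[k+1]≡[n+1]C[k+1]; k![n∸k]!∣n!)
open import Data.Nat.Combinatorics.Specification using (nCk≡n!/k![n-k]!)
open import Data.Nat.DivMod using (m/n*n≡m; m/n*n≤m)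
open import Data.Nat.ListAction using (sum)
open import Data.Nat.ListAction.Properties using (sum-++)
open import Data.Product using (_×_; _,_; proj₁; proj₂)
open import Data.Sum using (inj₁; inj₂)
open import Data.Vec using (Vec; []; _∷_; lookup; removeAt)
open import Data.Vec.Properties using (∷-injectiveʳ)
open import Data.Vec.Relation.Binary.Pointwise.Inductive as Pointwise using ([]; _∷_)
open import Function using (_∘_)
open import Level using (0ℓ)
open import Relation.Binary.PropositionalEquality
open import Relation.Nullary using (¬_; yes; no)
open import Relation.Unary using (Pred; Decidable)

ones≤n : ∀ {n} (x : Vec Bool n) → ones x ≤ n
ones≤n [] = z≤n
ones≤n (true ∷ x) = s≤s (ones≤n x)
ones≤n (false ∷ x) = m≤n⇒m≤1+n (ones≤n x)

≼-refl : ∀ {n} (x : Vec Bool n) → x ≼ x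
≼-refl x = Pointwise.refl B.≤-refl

ones-mono : ∀ {n} {a b : Vec Bool n} → a ≼ b → ones a ≤ ones b
ones-mono [] = z≤n
ones-mono (B.f≤t ∷ a≼b) = m≤n⇒m≤1+n (ones-mono a≼b)
ones-mono (B.b≤b {true} ∷ a≼b) = s≤s (ones-mono a≼b)
ones-mono (B.b≤b {false} ∷ a≼b) = ones-mono a≼b

≼-equal-ones : ∀ {n} {a b : Vec Bool n} → ones a ≡ ones b → a ≼ b → a ≡ b
≼-equal-ones e [] = refl
≼-equal-ones {b = true ∷ b} e (B.f≤t ∷ a≼b) =
  ⊥-elim (1+n≰n (subst (_≤ ones b) e (ones-mono a≼b)))
≼-equal-ones {a = true ∷ _} e (B.b≤b ∷ a≼b) = cong (true ∷_) (≼-equal-ones (suc-injective e) a≼b)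
≼-equal-ones {a = false ∷ _} e (B.b≤b ∷ a≼b) = cong (false ∷_) (≼-equal-ones e a≼b)

all-ones-top : ∀ {n} (x : Vec Bool n) → ones x ≡ n → ∀ y → y ≼ x
all-ones-top [] e [] = []
all-ones-top (true ∷ x) e (b ∷ y) = B.≤-maximum b ∷ all-ones-top x (suc-injective e) y
all-ones-top {suc n} (false ∷ x) e y = ⊥-elim (1+n≰n (subst (_≤ n) e (ones≤n x)))

allTuples-complete : ∀ n (x : Vec Bool n) → x ∈ allTuples n
allTuples-complete zero [] = here refl
allTuples-complete (suc n) (false ∷ x) = ∈-++⁺ˡ (∈-map⁺ (false ∷_) (allTuples-complete n x))
allTuples-complete (suc n) (true ∷ x) =
  ∈-++⁺ʳ (map (false ∷_) (allTuples n)) (∈-map⁺ (true ∷_) (allTuples-complete n x))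

allTuples-unique : ∀ n → Unique (allTuples n)
allTuples-unique zero = [] ∷ []
allTuples-unique (suc n) =
  Unique.++⁺ (Unique.map⁺ ∷-injectiveʳ (allTuples-unique n))
             (Unique.map⁺ ∷-injectiveʳ (allTuples-unique n)) disjoint
  where
  disjoint : ∀ {v} → ¬ (v ∈ map (false ∷_) (allTuples n) × v ∈ map (true ∷_) (allTuples n))
  disjoint (p , q) with ∈-map⁻ (false ∷_) p | ∈-map⁻ (true ∷_) q
  ... | _ , _ , refl | _ , _ , ()

∈-level⁻ : ∀ {n k} {x : Vec Bool n} → x ∈ level n k → ones x ≡ k
∈-level⁻ {n} {k} p = proj₂ (∈-filter⁻ (λ v → ones v ≟ k) {xs = allTuples n} p)

∈-level⁺ : ∀ {n k} {x : Vec Bool n} → ones x ≡ k → x ∈ level n k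
∈-level⁺ {n} {k} {x} e = ∈-filter⁺ (λ v → ones v ≟ k) (allTuples-complete n x) e

level-antichain : ∀ n k → IsAntichain (level n k)
level-antichain n k =
  Unique.filter⁺ (λ v → ones v ≟ k) (allTuples-unique n) ,
  λ p q a≼b → ≼-equal-ones (trans (∈-level⁻ p) (sym (∈-level⁻ q))) a≼b

length-filter-map : ∀ {X Y : Set} {P : Pred Y 0ℓ} (P? : Decidable P) (f : X → Y) (xs : List X) →
  length (filter P? (map f xs)) ≡ length (filter (P? ∘ f) xs)
length-filter-map P? f [] = refl
length-filter-map P? f (x ∷ xs) with P? (f x)
... | yes _ = cong suc (length-filter-map P? f xs)
... | no _ = length-filter-map P? f xs

-- Level k of {0,1}^n has (n choose k) members (Pascal's rule on the first coordinate).
length-level : ∀ n k → length (level n k) ≡ n C k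
length-level zero zero = refl
length-level zero (suc k) = refl
length-level (suc n) k = begin
  length (filter (ones≟ k) (F₀ ++ F₁))
    ≡⟨ cong length (filter-++ (ones≟ k) F₀ F₁) ⟩
  length (filter (ones≟ k) F₀ ++ filter (ones≟ k) F₁)
    ≡⟨ length-++ (filter (ones≟ k) F₀) ⟩
  length (filter (ones≟ k) F₀) + length (filter (ones≟ k) F₁)
    ≡⟨ cong₂ _+_ (length-filter-map (ones≟ k) (false ∷_) tuples)
                 (length-filter-map (ones≟ k) (true ∷_) tuples) ⟩
  length (level n k) + length (filter (λ v → suc (ones v) ≟ k) tuples)
    ≡⟨ pascal k ⟩
  suc n C k ∎
  where
  open ≡-Reasoning
  tuples = allTuples n
  F₀ = map (false ∷_) tuples
  F₁ = map (true ∷_) tuples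
  ones≟ : ∀ {m} k → Decidable (λ (v : Vec Bool m) → ones v ≡ k)
  ones≟ k v = ones v ≟ k
  -- Tuples starting with a one: none on level 0, and as many on level k+1 as level k has.
  pascal : ∀ k →
    length (level n k) + length (filter (λ v → suc (ones v) ≟ k) tuples) ≡ suc n C k
  pascal zero rewrite filter-none (λ v → suc (ones v) ≟ 0) (All.tabulate {xs = tuples} (λ _ ()))
                    | length-level n 0 = refl
  pascal (suc k) rewrite filter-≐ (λ v → suc (ones v) ≟ suc k) (λ v → ones v ≟ k)
                           (suc-injective , cong suc) tuples
                       | length-level n k | length-level n (suc k) =
    trans (+-comm (n C suc k) (n C k)) (nCk+nC[k+1]≡[n+1]C[k+1] n k)

unique-⊆-length : ∀ {X : Set} (U L : List X) → Unique U → (∀ {x} → x ∈ U → x ∈ L) →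
  length U ≤ length L
unique-⊆-length [] L _ _ = z≤n
unique-⊆-length (x ∷ U) L (x∉U ∷ uU) U⊆L with ∈-∃++ (U⊆L (here refl))
... | ys , zs , refl = ≤-trans
  (s≤s (unique-⊆-length U (ys ++ zs) uU (λ p → remove ys (U⊆L (there p)) (All.lookup x∉U p))))
  (≤-reflexive (sym (length-++-sucʳ ys x zs)))
  where
  remove : ∀ {y} ys → y ∈ ys ++ x ∷ zs → x ≢ y → y ∈ ys ++ zs
  remove [] (here e) x≢y = ⊥-elim (x≢y (sym e))
  remove [] (there p) _ = p
  remove (w ∷ ys) (here e) _ = here e
  remove (w ∷ ys) (there p) x≢y = there (remove ys p x≢y)

weight : ℕ → ℕ → ℕ
weight n k = k ! * (n ∸ k) !

weight≢0 : ∀ n k → NonZero (weight n k)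
weight≢0 n k = k !* (n ∸ k) !≢0

level-weight : ∀ n k → k ≤ n → length (level n k) * weight n k ≡ n !
level-weight n k k≤n = begin
  length (level n k) * weight n k ≡⟨ cong (_* weight n k) (length-level n k) ⟩
  (n C k) * weight n k            ≡⟨ cong (_* weight n k) (nCk≡n!/k![n-k]! k≤n) ⟩
  n ! / weight n k * weight n k   ≡⟨ m/n*n≡m (k![n∸k]!∣n! k≤n) ⟩
  n ! ∎
  where
  open ≡-Reasoning
  instance _ = weight≢0 n k

weight-top : ∀ n → weight n n ≡ n !
weight-top n rewrite n∸n≡0 n = *-identityʳ (n !)

weight-step : ∀ n a → a ≤ n → (suc n ∸ a) * weight n a ≡ weight (suc n) a
weight-step n a a≤n rewrite +-∸-assoc 1 a≤n = begin
  suc m * (a ! * m !)  ≡⟨ *-assoc (suc m) (a !) (m !) ⟨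
  suc m * a ! * m !    ≡⟨ cong (_* m !) (*-comm (suc m) (a !)) ⟩
  a ! * suc m * m !    ≡⟨ *-assoc (a !) (suc m) (m !) ⟩
  a ! * suc m ! ∎
  where
  open ≡-Reasoning
  m = n ∸ a

weight-sym : ∀ a b → weight (a + b) b ≡ weight (a + b) a
weight-sym a b rewrite m+n∸n≡m a b | m+n∸m≡n a b = *-comm (b !) (a !)

weight-antitone : ∀ n a b → a ≤ b → a + b ≤ n → weight n b ≤ weight n a
weight-antitone n a b a≤b a+b≤n with m≤n⇒m<n∨m≡n a+b≤n
... | inj₂ refl = ≤-reflexive (weight-sym a b)
weight-antitone (suc n) a b a≤b _ | inj₁ (s≤s a+b≤n) = begin
  weight (suc n) b         ≡⟨ weight-step n b b≤n ⟨
  (suc n ∸ b) * weight n b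
    ≤⟨ *-mono-≤ (∸-monoʳ-≤ (suc n) a≤b) (weight-antitone n a b a≤b a+b≤n) ⟩
  (suc n ∸ a) * weight n a ≡⟨ weight-step n a (≤-trans a≤b b≤n) ⟩
  weight (suc n) a ∎
  where
  open ≤-Reasoning
  b≤n = ≤-trans (m≤n+m b a) a+b≤n

-- The LYM induction works with pairwise incomparability instead of IsAntichain.
Incomparable : ∀ {n} → Vec Bool n → Vec Bool n → Set
Incomparable a b = ¬ (a ≼ b) × ¬ (b ≼ a)

antichain⇒incomparable : ∀ {n} (T : List (Vec Bool n)) → IsAntichain T → AllPairs Incomparable T
antichain⇒incomparable [] _ = []
antichain⇒incomparable (x ∷ T) (x∉T ∷ uT , comparable⇒≡) =
  All.tabulate (λ y∈T →
    (λ x≼y → All.lookup x∉T y∈T (comparable⇒≡ (here refl) (there y∈T) x≼y)) ,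
    (λ y≼x → All.lookup x∉T y∈T (sym (comparable⇒≡ (there y∈T) (here refl) y≼x))))
  ∷ antichain⇒incomparable T (uT , λ p q → comparable⇒≡ (there p) (there q))

mass : (n : ℕ) → List (Vec Bool n) → ℕ
mass n T = sum (map (weight n ∘ ones) T)

mass-++ : ∀ n (S T : List (Vec Bool n)) → mass n (S ++ T) ≡ mass n S + mass n T
mass-++ n S T = trans (cong sum (map-++ (weight n ∘ ones) S T)) (sum-++ (map _ S) (map _ T))

ones-removeAt : ∀ {n} (x : Vec Bool (suc n)) i → lookup x i ≡ false → ones (removeAt x i) ≡ ones x
ones-removeAt (false ∷ x) zero _ = refl
ones-removeAt (true ∷ y ∷ x) (suc i) x[i]≡0 = cong suc (ones-removeAt (y ∷ x) i x[i]≡0)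
ones-removeAt (false ∷ y ∷ x) (suc i) x[i]≡0 = ones-removeAt (y ∷ x) i x[i]≡0

removeAt-reflects-≼ : ∀ {n} (x y : Vec Bool (suc n)) i → lookup x i ≡ lookup y i →
  removeAt x i ≼ removeAt y i → x ≼ y
removeAt-reflects-≼ (a ∷ x) (.a ∷ y) zero refl x≼y = B.≤-refl ∷ x≼y
removeAt-reflects-≼ (a ∷ x@(_ ∷ _)) (b ∷ y@(_ ∷ _)) (suc i) x[i]≡y[i] (a≤b ∷ x≼y) =
  a≤b ∷ removeAt-reflects-≼ x y i x[i]≡y[i] x≼y

restrict : ∀ {n} → Fin (suc n) → List (Vec Bool (suc n)) → List (Vec Bool n)
restrict i [] = []
restrict i (x ∷ T) = if lookup x i then restrict i T else removeAt x i ∷ restrict i T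

zeroWeight : ∀ {n} → Fin (suc n) → Vec Bool (suc n) → ℕ
zeroWeight {n} i x = if lookup x i then 0 else weight n (ones x)

restrict-All : ∀ {n} {P : Pred (Vec Bool (suc n)) 0ℓ} {Q : Pred (Vec Bool n) 0ℓ} i →
  (∀ {y} → lookup y i ≡ false → P y → Q (removeAt y i)) →
  ∀ {T} → All P T → All Q (restrict i T)
restrict-All i f [] = []
restrict-All i f {y ∷ T} (py ∷ pT) with lookup y i in y[i]≡b
... | true = restrict-All i f pT
... | false = f y[i]≡b py ∷ restrict-All i f pT

restrict-incomparable : ∀ {n} i (T : List (Vec Bool (suc n))) →
  AllPairs Incomparable T → AllPairs Incomparable (restrict i T)
restrict-incomparable i [] [] = []
restrict-incomparable i (x ∷ T) (x∦T ∷ T∦) with lookup x i in x[i]≡b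
... | true = restrict-incomparable i T T∦
... | false = restrict-All i incomparable-removeAt x∦T ∷ restrict-incomparable i T T∦
  where
  incomparable-removeAt : ∀ {y} → lookup y i ≡ false → Incomparable x y →
    Incomparable (removeAt x i) (removeAt y i)
  incomparable-removeAt {y} y[i]≡0 (x⋠y , y⋠x) =
    (λ p → x⋠y (removeAt-reflects-≼ x y i (trans x[i]≡b (sym y[i]≡0)) p)) ,
    (λ p → y⋠x (removeAt-reflects-≼ y x i (trans y[i]≡0 (sym x[i]≡b)) p))

mass-restrict : ∀ {n} i (T : List (Vec Bool (suc n))) →
  mass n (restrict i T) ≡ sum (map (zeroWeight i) T)
mass-restrict i [] = refl
mass-restrict {n} i (x ∷ T) with lookup x i in x[i]≡b
... | true = mass-restrict i T
... | false = cong₂ _+_ (cong (weight n) (ones-removeAt x i x[i]≡b)) (mass-restrict i T)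

∑-zeros : ∀ {m} (x : Vec Bool m) c → ∑[ i < m ] (if lookup x i then 0 else c) ≡ (m ∸ ones x) * c
∑-zeros [] c = refl
∑-zeros (true ∷ x) c = ∑-zeros x c
∑-zeros {suc m} (false ∷ x) c rewrite +-∸-assoc 1 (ones≤n x) = cong (c +_) (∑-zeros x c)

∑-sum-comm : ∀ {X : Set} m (f : Fin m → X → ℕ) (T : List X) →
  ∑[ i < m ] sum (map (f i) T) ≡ sum (map (λ x → ∑[ i < m ] f i x) T)
∑-sum-comm m f [] = sum-replicate-zero m
∑-sum-comm m f (x ∷ T) =
  trans (∑-distrib-+ (λ i → f i x) (λ i → sum (map (f i) T)))
        (cong (∑[ i < m ] f i x +_) (∑-sum-comm m f T))

∑-≤-const : ∀ m (f : Fin m → ℕ) c → (∀ i → f i ≤ c) → ∑[ i < m ] f i ≤ m * c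
∑-≤-const zero f c _ = z≤n
∑-≤-const (suc m) f c f≤c = +-mono-≤ (f≤c zero) (∑-≤-const m (f ∘ suc) c (f≤c ∘ suc))

antichain-with-top : ∀ {n} {x : Vec Bool n} (T : List (Vec Bool n)) → AllPairs Incomparable T →
  x ∈ T → (∀ y → y ≼ x) → T ≡ x ∷ []
antichain-with-top (_ ∷ []) _ (here refl) _ = refl
antichain-with-top (a ∷ b ∷ T) (((_ , b⋠a) ∷ _) ∷ _) (here refl) top = ⊥-elim (b⋠a (top b))
antichain-with-top (a ∷ T) (a∦T ∷ _) (there x∈T) top =
  ⊥-elim (proj₁ (All.lookup a∦T x∈T) (top a))

lym : ∀ n (T : List (Vec Bool n)) → AllPairs Incomparable T → mass n T ≤ n !
lym zero [] _ = z≤n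
lym zero ([] ∷ []) _ = ≤-refl
lym zero ([] ∷ [] ∷ _) (((⋠ , _) ∷ _) ∷ _) = ⊥-elim (⋠ [])
lym (suc n) T T∦ with any? (λ x → ones x ≟ suc n) T
... | yes has-top with find has-top
...   | x , x∈T , ones≡ rewrite antichain-with-top T T∦ x∈T (all-ones-top x ones≡) | ones≡ =
  ≤-reflexive (trans (+-identityʳ _) (weight-top (suc n)))
lym (suc n) T T∦ | no no-top = begin
  mass (suc n) T
    ≡⟨ cong sum (map-cong-local (All.map (λ {x} → weight-as-∑ x) below-top)) ⟩
  sum (map (λ x → ∑[ i < suc n ] zeroWeight i x) T)
    ≡⟨ ∑-sum-comm (suc n) zeroWeight T ⟨
  ∑[ i < suc n ] sum (map (zeroWeight i) T)
    ≤⟨ ∑-≤-const (suc n) _ (n !) restriction-bound ⟩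
  suc n * n ! ∎
  where
  open ≤-Reasoning
  below-top : All (λ x → ones x ≤ n) T
  below-top = All.map (λ {x} ≢top → s≤s⁻¹ (≤∧≢⇒< (ones≤n x) ≢top)) (¬Any⇒All¬ T no-top)
  -- Each tuple's weight is spread over the restrictions at its zero coordinates.
  weight-as-∑ : ∀ x → ones x ≤ n → weight (suc n) (ones x) ≡ ∑[ i < suc n ] zeroWeight i x
  weight-as-∑ x x≤n = trans (sym (weight-step n (ones x) x≤n)) (sym (∑-zeros x (weight n (ones x))))
  restriction-bound : ∀ i → sum (map (zeroWeight i) T) ≤ n !
  restriction-bound i = ≤-trans (≤-reflexive (sym (mass-restrict i T)))
                                (lym n (restrict i T) (restrict-incomparable i T T∦))

weighted-count : ∀ {X : Set} {P : Pred X 0ℓ} (P? : Decidable P) (w : X → ℕ) {a b : ℕ} → a ≤ b →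
  (∀ {x} → P x → a ≤ w x) → (F : List X) → All (λ x → ¬ P x → b ≤ w x) F →
  ∀ L → length (filter P? F) ≤ L → b * length F + a * L ≤ sum (map w F) + b * L
weighted-count P? w {a} {b} a≤b light [] [] L _ =
  ≤-trans (≤-reflexive (cong (_+ a * L) (*-zeroʳ b))) (*-monoˡ-≤ L a≤b)
weighted-count P? w {a} {b} a≤b light (x ∷ F) (heavy ∷ heavies) L count≤L with P? x
... | yes px with suc L′ ← L | s≤s count≤L′ ← count≤L = begin
  b * suc (length F) + a * suc L′   ≡⟨ cong₂ _+_ (*-suc b (length F)) (*-suc a L′) ⟩
  (b + b * length F) + (a + a * L′) ≡⟨ interchange b _ a _ ⟩
  (b + a) + (b * length F + a * L′) ≤⟨ +-mono-≤ (+-monoʳ-≤ b (light px)) rest ⟩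
  (b + w x) + (sum (map w F) + b * L′) ≡⟨ cong (_+ (sum (map w F) + b * L′)) (+-comm b (w x)) ⟩
  (w x + b) + (sum (map w F) + b * L′) ≡⟨ interchange (w x) b _ _ ⟩
  (w x + sum (map w F)) + (b + b * L′) ≡⟨ cong (w x + sum (map w F) +_) (*-suc b L′) ⟨
  (w x + sum (map w F)) + b * suc L′ ∎
  where
  open ≤-Reasoning
  rest = weighted-count P? w a≤b light F heavies L′ count≤L′
... | no ¬px = begin
  b * suc (length F) + a * L   ≡⟨ cong (_+ a * L) (*-suc b (length F)) ⟩
  b + b * length F + a * L     ≡⟨ +-assoc b _ _ ⟩
  b + (b * length F + a * L)   ≤⟨ +-mono-≤ (heavy ¬px) rest ⟩
  w x + (sum (map w F) + b * L) ≡⟨ +-assoc (w x) _ _ ⟨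
  w x + sum (map w F) + b * L ∎
  where
  open ≤-Reasoning
  rest = weighted-count P? w a≤b light F heavies L count≤L

two-level-bound : ∀ {n} A B (F : List (Vec Bool n)) → Unique F → A ≤ n → B ≤ n →
  weight n A ≤ weight n B → All (λ x → ones x ≢ A → weight n B ≤ weight n (ones x)) F →
  mass n F ≤ n ! + n ! → length F ≤ length (level n A) + length (level n B)
two-level-bound {n} A B F uF A≤n B≤n wA≤wB heavy massF =
  *-cancelˡ-≤ wB (+-cancelʳ-≤ (n !) _ _ (begin
    wB * length F + n !     ≡⟨ cong (wB * length F +_) (level-mass A A≤n) ⟨
    wB * length F + wA * LA ≤⟨ count ⟩
    mass n F + wB * LA      ≤⟨ +-monoˡ-≤ (wB * LA) massF ⟩
    n ! + n ! + wB * LA     ≡⟨ +-assoc (n !) (n !) (wB * LA) ⟩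
    n ! + (n ! + wB * LA)   ≡⟨ +-comm (n !) _ ⟩
    n ! + wB * LA + n !     ≡⟨ cong (λ z → z + wB * LA + n !) (level-mass B B≤n) ⟨
    wB * LB + wB * LA + n ! ≡⟨ cong (_+ n !) (*-distribˡ-+ wB LB LA) ⟨
    wB * (LB + LA) + n !    ≡⟨ cong (λ z → wB * z + n !) (+-comm LB LA) ⟩
    wB * (LA + LB) + n ! ∎))
  where
  open ≤-Reasoning
  wA = weight n A
  wB = weight n B
  LA = length (level n A)
  LB = length (level n B)
  instance _ = weight≢0 n B
  level-mass : ∀ K → K ≤ n → weight n K * length (level n K) ≡ n !
  level-mass K K≤n = trans (*-comm (weight n K) _) (level-weight n K K≤n)
  light : ∀ {x} → ones x ≡ A → wA ≤ weight n (ones x)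
  light e = ≤-reflexive (cong (weight n) (sym e))
  onA≤LA : length (filter (λ v → ones v ≟ A) F) ≤ LA
  onA≤LA = unique-⊆-length _ _ (Unique.filter⁺ (λ v → ones v ≟ A) uF)
             (λ p → ∈-level⁺ (proj₂ (∈-filter⁻ (λ v → ones v ≟ A) {xs = F} p)))
  count : wB * length F + wA * LA ≤ mass n F + wB * LA
  count = weighted-count (λ v → ones v ≟ A) (weight n ∘ ones) wA≤wB (λ {x} → light {x})
                         F heavy LA onA≤LA

weight-below-k : ∀ n k a → k + k ≤ n → a ≤ suc k → a ≢ suc k → weight n k ≤ weight n a
weight-below-k n k a 2k≤n a≤k+1 a≢k+1 =
  weight-antitone n a k a≤k (≤-trans (+-monoˡ-≤ k a≤k) 2k≤n)
  where a≤k = s≤s⁻¹ (≤∧≢⇒< a≤k+1 a≢k+1)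

weight-below-k+1 : ∀ n k a → k + k ≤ n → a ≤ suc k → a ≢ k → weight n (suc k) ≤ weight n a
weight-below-k+1 n k a 2k≤n a≤k+1 a≢k with a ≟ suc k
... | yes refl = ≤-refl
... | no a≢k+1 = weight-antitone n a (suc k) a≤k+1 (begin
  a + suc k ≡⟨ +-suc a k ⟩
  suc a + k ≤⟨ +-monoˡ-≤ k a<k ⟩
  k + k     ≤⟨ 2k≤n ⟩
  n ∎)
  where
  open ≤-Reasoning
  a<k = ≤∧≢⇒< (s≤s⁻¹ (≤∧≢⇒< a≤k+1 a≢k+1)) a≢k

adjacent-levels-bound : ∀ {n} k (F : List (Vec Bool n)) → Unique F → suc k ≤ n → k + k ≤ n →
  All (λ x → ones x ≤ suc k) F → mass n F ≤ n ! + n ! →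
  length F ≤ length (level n k) + length (level n (suc k))
adjacent-levels-bound {n} k F uF k<n 2k≤n below massF with weight n (suc k) ≤? weight n k
... | yes w[k+1]≤w[k] =
  subst (length F ≤_) (+-comm (length (level n (suc k))) _)
    (two-level-bound (suc k) k F uF k<n (<⇒≤ k<n) w[k+1]≤w[k]
      (All.map (λ {x} → weight-below-k n k (ones x) 2k≤n) below) massF)
... | no w[k+1]≰w[k] =
  two-level-bound k (suc k) F uF (<⇒≤ k<n) k<n (≰⇒≥ w[k+1]≰w[k])
    (All.map (λ {x} → weight-below-k+1 n k (ones x) 2k≤n) below) massF

levels-in-A' : ∀ n t → InA' n t (levelPred n t) (level n t)
levels-in-A' n zero =
  ([] , λ ()) , level-antichain n 0 , (λ ()) , [] , All.tabulate (λ p → ≤-reflexive (∈-level⁻ p))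
levels-in-A' n (suc k) =
  level-antichain n k , level-antichain n (suc k) ,
  (λ a∈ b∈ b≼a → 1+n≰n (subst₂ _≤_ (∈-level⁻ b∈) (∈-level⁻ a∈) (ones-mono b≼a))) ,
  All.tabulate (λ p → m≤n⇒m≤1+n (≤-reflexive (∈-level⁻ p))) ,
  All.tabulate (λ p → ≤-reflexive (∈-level⁻ p))

levels-maximal : ∀ n t → 1 ≤ n → t ≤ n / 2 + 1 → (F : List (Vec Bool n)) → Unique F →
  All (λ x → ones x ≤ t) F → mass n F ≤ n ! + n ! →
  length F ≤ length (levelPred n t) + length (level n t)
levels-maximal n zero _ _ F uF below _ =
  unique-⊆-length F (level n 0) uF (λ p → ∈-level⁺ (n≤0⇒n≡0 (All.lookup below p)))
levels-maximal n (suc k) 1≤n t≤n/2+1 F uF below massF =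
  adjacent-levels-bound k F uF (1+k≤n k 2k≤n) 2k≤n below massF
  where
  k≤n/2 : k ≤ n / 2
  k≤n/2 = s≤s⁻¹ (subst (suc k ≤_) (+-comm (n / 2) 1) t≤n/2+1)
  2k≤n : k + k ≤ n
  2k≤n = begin
    k + k     ≡⟨ cong (k +_) (+-identityʳ k) ⟨
    2 * k     ≡⟨ *-comm 2 k ⟩
    k * 2     ≤⟨ *-monoˡ-≤ 2 k≤n/2 ⟩
    n / 2 * 2 ≤⟨ m/n*n≤m n 2 ⟩
    n ∎
    where open ≤-Reasoning
  1+k≤n : ∀ j → j + j ≤ n → suc j ≤ n
  1+k≤n zero _ = 1≤n
  1+k≤n (suc j) 2j≤n = ≤-trans (s≤s (m≤n+m (suc j) j)) 2j≤n

corollary6 : (n t : ℕ) → 1 ≤ n → t ≤ n / 2 + 1 →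
    InA' n t (levelPred n t) (level n t)
    × ((S' S'' : List (Vec Bool n)) → InA' n t S' S'' →
        length S' + length S'' ≤ length (levelPred n t) + length (level n t))
corollary6 n t 1≤n t≤n/2+1 = levels-in-A' n t , maximal
  where
  maximal : (S' S'' : List (Vec Bool n)) → InA' n t S' S'' →
    length S' + length S'' ≤ length (levelPred n t) + length (level n t)
  maximal S' S'' (anti' , anti'' , ⋡ , below' , below'') =
    subst (_≤ _) (length-++ S')
      (levels-maximal n t 1≤n t≤n/2+1 (S' ++ S'') unique (++⁺ below' below'') mass≤)
    where
    -- The two antichains are disjoint: a common member would be comparable to itself.
    unique : Unique (S' ++ S'')
    unique = Unique.++⁺ (proj₁ anti') (proj₁ anti'')
                        (λ (a∈S' , a∈S'') → ⋡ a∈S' a∈S'' (≼-refl _))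
    mass≤ : mass n (S' ++ S'') ≤ n ! + n !
    mass≤ = subst (_≤ n ! + n !) (sym (mass-++ n S' S''))
      (+-mono-≤ (lym n S' (antichain⇒incomparable S' anti'))
                (lym n S'' (antichain⇒incomparable S'' anti'')))
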